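{- For every $d,\zeta\in(0,1]$ there exist an integer $n_3$, a real $\rho_3=\rho_3(d,\zeta)>0$, and an integer $\gamma=\gamma(d,\zeta)$ such that the following holds for all $n\geq n_3$ and $\rho<\rho_3$. Let $H$ be an $n$-vertex $(\rho,d)$-dense $3$-graph. Then all but at most $\zeta n$ vertices of $H$ can be covered using at most $\gamma$ vertex-disjoint (tight) paths in $H$.
   Context: A $3$-graph is a $3$-uniform hypergraph. For $X\subseteq V(H)$ let $e_H(X)=|E(H)\cap\binom{X}{3}|$. An $n$-vertex $3$-graph $H$ is $(\rho,d)$-dense if $e_H(X)\geq d\binom{|X|}{3}-\rho n^3$ for every $X\subseteq V(H)$. A (tight) path is a $3$-graph on vertices $v_1,\dots,v_k$ with edges $\{v_i,v_{i+1},v_{i+2}\}$, $i\in[1,k-2]$; a path in $H$ is a subgraph of $H$ of this form.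
   Formalization: The parameters d, ζ ∈ (0,1] and every ρ < ρ₃ are taken over the rationals instead of the reals. -}

module Defs where

open import Data.Bool using (Bool; true; false)
open import Data.Bool.Properties using () renaming (_≟_ to _≟B_)
open import Data.Nat as ℕ using (ℕ; _∸_; _^_)
open import Data.Nat.Combinatorics using (_C_)
open import Data.Fin using (Fin)
open import Data.Fin.Properties using (_<?_)
open import Data.Fin.Subset using (Subset; _∈_; ∣_∣)
open import Data.Fin.Subset.Properties using (_∈?_)
open import Data.List using (List; []; _∷_; allFin; concatMap; map; filter; length; concat)
open import Data.List.Relation.Unary.All using (All)
open import Data.List.Relation.Unary.Unique.Propositional using (Unique)
open import Data.Product using (_×_; _,_; ∃-syntax)
open import Data.Unit using (⊤)
open import Data.Integer using (+_)
open import Data.Rational using (ℚ; _/_; _*_; _-_; _≤_; _<_; 0ℚ; 1ℚ)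
open import Relation.Nullary.Decidable using (_×-dec_)
open import Relation.Binary.PropositionalEquality using (_≡_)

⟦_⟧ : ℕ → ℚ
⟦ m ⟧ = (+ m) / 1

-- A 3-uniform hypergraph on vertex set Fin n: a symmetric edge indicator
-- on triples, false on triples with a repeated vertex.
record 3Graph (n : ℕ) : Set where
  field
    edge     : Fin n → Fin n → Fin n → Bool
    sym₁₂    : ∀ a b c → edge a b c ≡ edge b a c
    sym₂₃    : ∀ a b c → edge a b c ≡ edge a c b
    loopless : ∀ a b → edge a a b ≡ false
open 3Graph public

triples : (n : ℕ) → List (Fin n × Fin n × Fin n)
triples n = concatMap (λ i → concatMap (λ j → map (λ k → (i , j , k)) (allFin n)) (allFin n)) (allFin n)

eH : ∀ {n} → 3Graph n → Subset n → ℕ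
eH {n} H X = length (filter
  (λ { (i , j , k) → (i <? j) ×-dec (j <? k) ×-dec (i ∈? X) ×-dec (j ∈? X)
                      ×-dec (k ∈? X) ×-dec (edge H i j k ≟B true) })
  (triples n))

Dense : ∀ {n} → ℚ → ℚ → 3Graph n → Set
Dense {n} ρ d H = ∀ (X : Subset n) → d * ⟦ ∣ X ∣ C 3 ⟧ - ρ * ⟦ n ^ 3 ⟧ ≤ ⟦ eH H X ⟧

TightEdges : ∀ {n} → 3Graph n → List (Fin n) → Set
TightEdges H (x ∷ y ∷ z ∷ rest) = (edge H x y z ≡ true) × TightEdges H (y ∷ z ∷ rest)
TightEdges H _ = ⊤

IsPath : ∀ {n} → 3Graph n → List (Fin n) → Set
IsPath H vs = Unique vs × TightEdges H vs

CoverablePaths : ∀ {n} → 3Graph n → ℚ → ℕ → Set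
CoverablePaths {n} H ζ γ =
  ∃[ Ps ] (length Ps ℕ.≤ γ × All (IsPath H) Ps × Unique (concat Ps)
           × ⟦ n ∸ length (concat Ps) ⟧ ≤ ζ * ⟦ n ⟧)

module Submission where

-- While more than ζn vertices are uncovered, the uncovered set R spans, by density,
-- more than 6Ln² edges, where L = n/(6K) for a large constant K. Call an edge inside R live if none of
-- its pairs has been deleted, and repeatedly delete a pair of codegree < L lying in a live edge: each
-- deletion destroys fewer than 6L ordered live triples and at most n² pairs can be deleted, so live
-- edges survive, and then all pairs of every live edge have codegree ≥ L. In that robust family a
-- tight path on L vertices grows greedily by prepending a fresh common neighbour of its first two
-- vertices. Each round covers L new vertices, and γ·L > n, so fewer than γ rounds occur.

open import Algebra.Bundles using (CommutativeMonoid)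
import Algebra.Properties.CommutativeSemigroup as CommutativeSemigroupProperties
open import Data.Bool using (Bool; true; false; _∧_; _∨_; not)
import Data.Bool as Bool
open import Data.Bool.Properties using (∧-comm; ∨-comm; ∧-commutativeMonoid; ∨-commutativeMonoid)
open import Data.Empty using (⊥-elim)
open import Data.Fin using (Fin; zero; suc)
import Data.Fin as Fin
open import Data.Fin.Properties using (_≟_; any?)
open import Data.Fin.Subset using (Subset; ∣_∣; _∈_)
open import Data.Fin.Subset.Properties using (_∈?_)
open import Data.Integer using (+_)
import Data.Integer as ℤ
import Data.Integer.Properties as ℤ
import Data.Integer.Tactic.RingSolver as ℤ-Solver
open import Data.List using (List; []; _∷_; length; filter; concatMap; concat; map; allFin; _++_)
import Data.List as List
open import Data.List.Membership.Propositional using (_∉_)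
open import Data.List.Properties using (filter-++; length-++; map-tabulate)
open import Data.List.Relation.Binary.Disjoint.Propositional using (Disjoint)
open import Data.List.Relation.Unary.All using (All; []; _∷_)
import Data.List.Relation.Unary.All as All
open import Data.List.Relation.Unary.All.Properties using (¬Any⇒All¬)
import Data.List.Relation.Unary.Any as Any
open import Data.List.Relation.Unary.Unique.Propositional using (Unique; []; _∷_)
open import Data.List.Relation.Unary.Unique.Propositional.Properties using (Unique[x∷xs]⇒x∉xs; ++⁺)
open import Data.Nat using (ℕ; zero; suc; _+_; _*_; _∸_; _^_; _≤_; _<_; _≥_; z≤n; s≤s; _<?_; NonZero)
open import Data.Nat.Combinatorics using (_C_; nC1≡n; nCk+nC[k+1]≡[n+1]C[k+1])
open import Data.Nat.Coprimality using (1-coprimeTo)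
open import Data.Nat.DivMod using (_/_; _%_; m≡m%n+[m/n]*n; m%n<n; m*n/n≡m; m/n*n≤m; /-monoˡ-≤)
open import Data.Nat.Induction using (<-wellFounded)
open import Data.Nat.Properties
  using (module ≤-Reasoning; ≤-refl; ≤-trans; ≤-reflexive; <⇒≤; ≮⇒≥; <⇒≱; ≰⇒>; <-irrefl; ≤-<-trans; <-≤-trans;
         +-comm; +-suc; +-identityʳ; +-mono-≤; +-monoˡ-≤; +-monoʳ-≤; +-mono-<-≤; +-mono-≤-<; +-monoˡ-<;
         *-comm; *-assoc; *-suc; *-identityʳ; *-distribˡ-+; *-mono-≤; *-monoˡ-≤; *-monoʳ-≤; *-monoʳ-<;
         *-cancelˡ-<; m*n≢0; ^-monoˡ-<; m≤m+n; m≤n+m; m+n∸n≡m; m∸n+n≡m; n≤1+n)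
open import Data.Nat.Tactic.RingSolver using (solve-∀)
open import Data.Product using (_×_; _,_; ∃-syntax)
open import Data.Rational using (ℚ; 0ℚ; 1ℚ)
import Data.Rational as ℚ
import Data.Rational.Properties as ℚ
import Data.Rational.Unnormalised as ℚᵘ
import Data.Rational.Unnormalised.Properties as ℚᵘ
open import Data.Sum using (_⊎_; inj₁; inj₂)
open import Data.Unit using (tt)
open import Data.Vec using (tabulate; lookup)
open import Data.Vec.Properties using ([]=⇒lookup; lookup∘tabulate)
open import Function using (id)
open import Induction.WellFounded using (Acc; acc)
open import Level using (0ℓ)
open import Relation.Binary.PropositionalEquality
  using (_≡_; _≢_; refl; sym; trans; cong; cong₂; subst; subst₂; module ≡-Reasoning)
open import Relation.Nullary using (Dec; does; yes; no)
open import Relation.Nullary.Decidable using (dec-true; dec-false; _×-dec_)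
open import Relation.Unary using (Pred; Decidable)
open import Algebra.Properties.Semiring.Sum Data.Nat.Properties.+-*-semiring
  using (sum; sum-replicate-zero; ∑-distrib-+; sum-cong-≗; *-distribˡ-sum)

open import Defs

-- Indicator sums over Fin n

𝟙 : Bool → ℕ
𝟙 true  = 1
𝟙 false = 0

𝟙≤1 : ∀ b → 𝟙 b ≤ 1
𝟙≤1 true  = ≤-refl
𝟙≤1 false = z≤n

𝟙-∧ : ∀ x y → 𝟙 (x ∧ y) ≡ 𝟙 x * 𝟙 y
𝟙-∧ true  y = sym (+-identityʳ (𝟙 y))
𝟙-∧ false y = refl

𝟙-∨ : ∀ x y → 𝟙 (x ∨ y) ≤ 𝟙 x + 𝟙 y
𝟙-∨ true  y = s≤s z≤n
𝟙-∨ false y = ≤-refl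

δ : ∀ {n} → Fin n → Fin n → ℕ
δ i j = 𝟙 (does (i ≟ j))

sum-mono-≤ : ∀ {n} {f g : Fin n → ℕ} → (∀ i → f i ≤ g i) → sum f ≤ sum g
sum-mono-≤ {zero}  f≤g = z≤n
sum-mono-≤ {suc n} f≤g = +-mono-≤ (f≤g zero) (sum-mono-≤ (λ i → f≤g (suc i)))

sum-mono-< : ∀ {n} {f g : Fin n → ℕ} → (∀ i → f i ≤ g i) → ∀ j → f j < g j → sum f < sum g
sum-mono-< f≤g zero    fj<gj = +-mono-<-≤ fj<gj (sum-mono-≤ (λ i → f≤g (suc i)))
sum-mono-< f≤g (suc j) fj<gj = +-mono-≤-< (f≤g zero) (sum-mono-< (λ i → f≤g (suc i)) j fj<gj)

sum-const : ∀ n c → sum {n} (λ _ → c) ≡ n * c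
sum-const zero    c = refl
sum-const (suc n) c = cong (_+_ c) (sum-const n c)

sum-zero : ∀ {n} {f : Fin n → ℕ} → (∀ i → f i ≡ 0) → sum f ≡ 0
sum-zero {n} f≡0 = trans (sum-cong-≗ f≡0) (sum-replicate-zero n)

sum≤n*c : ∀ {n c} {f : Fin n → ℕ} → (∀ i → f i ≤ c) → sum f ≤ n * c
sum≤n*c {n} {c} f≤c = ≤-trans (sum-mono-≤ f≤c) (≤-reflexive (sum-const n c))

sum-δ : ∀ {n} a (f : Fin n → ℕ) → sum (λ i → δ i a * f i) ≡ f a
sum-δ {suc n} zero f =
  trans (cong₂ _+_ (+-identityʳ (f zero)) (sum-replicate-zero n)) (+-identityʳ (f zero))
sum-δ {suc n} (suc a) f = sum-δ a (λ i → f (suc i))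

∑³ : ∀ {n} → (Fin n → Fin n → Fin n → ℕ) → ℕ
∑³ f = sum λ a → sum λ b → sum λ c → f a b c

∑³-mono-≤ : ∀ {n} {f g : Fin n → Fin n → Fin n → ℕ} → (∀ a b c → f a b c ≤ g a b c) → ∑³ f ≤ ∑³ g
∑³-mono-≤ f≤g = sum-mono-≤ λ a → sum-mono-≤ λ b → sum-mono-≤ λ c → f≤g a b c

infixl 6 _+³_

_+³_ : ∀ {n} → (f g : Fin n → Fin n → Fin n → ℕ) → Fin n → Fin n → Fin n → ℕ
(f +³ g) a b c = f a b c + g a b c

∑³-distrib-+ : ∀ {n} (f g : Fin n → Fin n → Fin n → ℕ) → ∑³ (f +³ g) ≡ ∑³ f + ∑³ g
∑³-distrib-+ f g = trans
  (sum-cong-≗ λ a → trans (sum-cong-≗ λ b → ∑-distrib-+ (f a b) (g a b))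
                          (∑-distrib-+ (λ b → sum (f a b)) (λ b → sum (g a b))))
  (∑-distrib-+ (λ a → sum λ b → sum (f a b)) (λ a → sum λ b → sum (g a b)))

sum²-δ : ∀ {n} w (g : Fin n → Fin n → ℕ) → sum (λ b → sum (λ c → δ b w * g b c)) ≡ sum (g w)
sum²-δ w g = trans (sum-cong-≗ λ b → sym (*-distribˡ-sum (δ b w) (g b))) (sum-δ w (λ b → sum (g b)))

∑³-δ : ∀ {n} u (g : Fin n → Fin n → Fin n → ℕ) → ∑³ (λ a b c → δ a u * g a b c) ≡ sum (λ b → sum (g u b))
∑³-δ u g = trans
  (sum-cong-≗ λ a → trans (sum-cong-≗ λ b → sym (*-distribˡ-sum (δ a u) (g a b))) (sym (*-distribˡ-sum (δ a u) (λ b → sum (g a b)))))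
  (sum-δ u (λ a → sum λ b → sum (g a b)))

∑³-pin₁₂ : ∀ {n} u w (f : Fin n → Fin n → Fin n → ℕ) → ∑³ (λ a b c → δ a u * (δ b w * f a b c)) ≡ sum (f u w)
∑³-pin₁₂ u w f = trans (∑³-δ u (λ a b c → δ b w * f a b c)) (sum²-δ w (f u))

∑³-pin₁₃ : ∀ {n} u w (f : Fin n → Fin n → Fin n → ℕ) → ∑³ (λ a b c → δ a u * (δ c w * f a b c)) ≡ sum (λ b → f u b w)
∑³-pin₁₃ u w f = trans (∑³-δ u (λ a b c → δ c w * f a b c)) (sum-cong-≗ λ b → sum-δ w (f u b))

∑³-pin₂₃ : ∀ {n} u w (f : Fin n → Fin n → Fin n → ℕ) → ∑³ (λ a b c → δ b u * (δ c w * f a b c)) ≡ sum (λ a → f a u w)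
∑³-pin₂₃ u w f = sum-cong-≗ λ a → trans (sum²-δ u (λ b c → δ c w * f a b c)) (sum-δ w (f a u))

module _ {A : Set} {P : Pred A 0ℓ} (P? : Decidable P) where

  length-filter-tabulate : ∀ {m} (h : Fin m → A) → length (filter P? (List.tabulate h)) ≡ sum (λ i → 𝟙 (does (P? (h i))))
  length-filter-tabulate {zero}  h = refl
  length-filter-tabulate {suc m} h with does (P? (h zero))
  ... | true  = cong suc (length-filter-tabulate (λ i → h (suc i)))
  ... | false = length-filter-tabulate (λ i → h (suc i))

  length-filter-concatMap : ∀ {B : Set} {m} (f : B → List A) (h : Fin m → B) →
    length (filter P? (concatMap f (List.tabulate h))) ≡ sum (λ i → length (filter P? (f (h i))))
  length-filter-concatMap {m = zero}  f h = refl
  length-filter-concatMap {m = suc m} f h = begin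
    length (filter P? (f (h zero) ++ rest))               ≡⟨ cong length (filter-++ P? (f (h zero)) rest) ⟩
    length (filter P? (f (h zero)) ++ filter P? rest)     ≡⟨ length-++ (filter P? (f (h zero))) ⟩
    length (filter P? (f (h zero))) + length (filter P? rest) ≡⟨ cong (_+_ (length (filter P? (f (h zero))))) (length-filter-concatMap f (λ i → h (suc i))) ⟩
    sum (λ i → length (filter P? (f (h i))))              ∎
    where
    open ≡-Reasoning
    rest = concatMap f (List.tabulate (λ i → h (suc i)))

length-filter-triples : ∀ {n} {P : Pred (Fin n × Fin n × Fin n) 0ℓ} (P? : Decidable P) →
  length (filter P? (triples n)) ≡ ∑³ (λ i j k → 𝟙 (does (P? (i , j , k))))
length-filter-triples {n} P? =
  trans (length-filter-concatMap P? (λ i → concatMap (λ j → map (λ k → (i , j , k)) (allFin n)) (allFin n)) id)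
    (sum-cong-≗ λ i → trans (length-filter-concatMap P? (λ j → map (λ k → (i , j , k)) (allFin n)) id)
      (sum-cong-≗ λ j → trans (cong (λ xs → length (filter P? xs)) (map-tabulate id (λ k → (i , j , k))))
                              (length-filter-tabulate P? (λ k → (i , j , k)))))

𝟙-does-≤ : ∀ {Q : Set} {b} (Q? : Dec Q) → (Q → b ≡ true) → 𝟙 (does Q?) ≤ 𝟙 b
𝟙-does-≤ (yes q) q⇒b rewrite q⇒b q = ≤-refl
𝟙-does-≤ (no _)  _   = z≤n

_∈ᵇ_ : ∀ {n} → Fin n → List (Fin n) → Bool
z ∈ᵇ xs = does (Any.any? (z ≟_) xs)

𝟙-∈ᵇ-∷ : ∀ {n} {v : Fin n} {vs} → Unique (v ∷ vs) → ∀ z → 𝟙 (z ∈ᵇ (v ∷ vs)) ≡ δ z v + 𝟙 (z ∈ᵇ vs)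
𝟙-∈ᵇ-∷ {v = v} {vs} uniq z with z ≟ v
... | yes refl rewrite dec-false (Any.any? (z ≟_) vs) (Unique[x∷xs]⇒x∉xs uniq) = refl
... | no _ = refl

∈ᵇ-false⇒∉ : ∀ {n} {z : Fin n} xs → z ∈ᵇ xs ≡ false → z ∉ xs
∈ᵇ-false⇒∉ {z = z} xs z∉ᵇxs z∈xs with () ← trans (sym (dec-true (Any.any? (z ≟_) xs) z∈xs)) z∉ᵇxs

sum-∈ᵇ : ∀ {n} {xs : List (Fin n)} → Unique xs → sum (λ z → 𝟙 (z ∈ᵇ xs)) ≡ length xs
sum-∈ᵇ {n} {[]} [] = sum-replicate-zero n
sum-∈ᵇ {n} {v ∷ vs} uniq@(_ ∷ uniq′) = begin
  sum (λ z → 𝟙 (z ∈ᵇ (v ∷ vs)))           ≡⟨ sum-cong-≗ (𝟙-∈ᵇ-∷ uniq) ⟩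
  sum (λ z → δ z v + 𝟙 (z ∈ᵇ vs))          ≡⟨ ∑-distrib-+ (λ z → δ z v) (λ z → 𝟙 (z ∈ᵇ vs)) ⟩
  sum (λ z → δ z v) + sum (λ z → 𝟙 (z ∈ᵇ vs)) ≡⟨ cong₂ _+_ (sum-δ₁ v) (sum-∈ᵇ uniq′) ⟩
  1 + length vs                              ∎
  where
  open ≡-Reasoning
  sum-δ₁ : ∀ v → sum (λ z → δ z v) ≡ 1
  sum-δ₁ v = trans (sum-cong-≗ (λ z → sym (*-identityʳ (δ z v)))) (sum-δ v (λ _ → 1))

outside : ∀ {n} → List (Fin n) → Subset n
outside xs = tabulate (λ v → not (v ∈ᵇ xs))

∣tabulate∣ : ∀ {n} (f : Fin n → Bool) → ∣ tabulate f ∣ ≡ sum (λ v → 𝟙 (f v))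
∣tabulate∣ {zero}  f = refl
∣tabulate∣ {suc n} f with f zero
... | true  = cong suc (∣tabulate∣ (λ v → f (suc v)))
... | false = ∣tabulate∣ (λ v → f (suc v))

∣outside∣+length : ∀ {n} {xs : List (Fin n)} → Unique xs → ∣ outside xs ∣ + length xs ≡ n
∣outside∣+length {n} {xs} uniq = begin
  ∣ outside xs ∣ + length xs                                  ≡⟨ cong₂ _+_ (∣tabulate∣ (λ v → not (v ∈ᵇ xs))) (sym (sum-∈ᵇ uniq)) ⟩
  sum (λ v → 𝟙 (not (v ∈ᵇ xs))) + sum (λ v → 𝟙 (v ∈ᵇ xs))  ≡⟨ ∑-distrib-+ (λ v → 𝟙 (not (v ∈ᵇ xs))) _ ⟨
  sum (λ v → 𝟙 (not (v ∈ᵇ xs)) + 𝟙 (v ∈ᵇ xs))              ≡⟨ sum-cong-≗ (λ v → 𝟙-not+𝟙 (v ∈ᵇ xs)) ⟩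
  sum {n} (λ _ → 1)                                           ≡⟨ sum-const n 1 ⟩
  n * 1                                                       ≡⟨ *-identityʳ n ⟩
  n                                                           ∎
  where
  open ≡-Reasoning
  𝟙-not+𝟙 : ∀ b → 𝟙 (not b) + 𝟙 b ≡ 1
  𝟙-not+𝟙 true  = refl
  𝟙-not+𝟙 false = refl

-- Deleting pairs from the edges inside a vertex set

module ∧ = CommutativeSemigroupProperties (CommutativeMonoid.commutativeSemigroup ∧-commutativeMonoid)
module ∨ = CommutativeSemigroupProperties (CommutativeMonoid.commutativeSemigroup ∨-commutativeMonoid)

Pair : ℕ → Set
Pair n = Fin n × Fin n

covers : ∀ {n} → Pair n → Fin n → Fin n → Bool
covers (u , w) a b = (does (a ≟ u) ∧ does (b ≟ w)) ∨ (does (a ≟ w) ∧ does (b ≟ u))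

covers-sym : ∀ {n} (p : Pair n) a b → covers p a b ≡ covers p b a
covers-sym (u , w) a b = trans
  (cong₂ _∨_ (∧-comm (does (a ≟ u)) _) (∧-comm (does (a ≟ w)) _))
  (∨-comm (does (b ≟ w) ∧ does (a ≟ u)) _)

𝟙-covers : ∀ {n} u w (a b : Fin n) → 𝟙 (covers (u , w) a b) ≤ δ a u * δ b w + δ a w * δ b u
𝟙-covers u w a b = ≤-trans (𝟙-∨ (does (a ≟ u) ∧ does (b ≟ w)) _)
  (≤-reflexive (cong₂ _+_ (𝟙-∧ (does (a ≟ u)) _) (𝟙-∧ (does (a ≟ w)) _)))

deleted : ∀ {n} → List (Pair n) → Fin n → Fin n → Bool
deleted []      a b = false
deleted (p ∷ D) a b = covers p a b ∨ deleted D a b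

deleted-sym : ∀ {n} (D : List (Pair n)) a b → deleted D a b ≡ deleted D b a
deleted-sym []      a b = refl
deleted-sym (p ∷ D) a b = cong₂ _∨_ (covers-sym p a b) (deleted-sym D a b)

∧-true-l : ∀ x {y} → x ∧ y ≡ true → x ≡ true
∧-true-l true _ = refl

∧-true-r : ∀ x {y} → x ∧ y ≡ true → y ≡ true
∧-true-r true p = p

𝟙-not-∨ : ∀ x y → 𝟙 (not (x ∨ y)) ≤ 𝟙 (not y)
𝟙-not-∨ true  y = z≤n
𝟙-not-∨ false y = ≤-refl

not-true : ∀ {x} → not x ≡ true → x ≡ false
not-true {false} _ = refl

∨-false-l : ∀ x {y} → x ∨ y ≡ false → x ≡ false
∨-false-l false _ = refl

𝟙-∧-not-∨ : ∀ x y h → 𝟙 (x ∧ not y) ≤ 𝟙 (x ∧ not (h ∨ y)) + 𝟙 (x ∧ not y) * 𝟙 h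
𝟙-∧-not-∨ false y     h     = z≤n
𝟙-∧-not-∨ true  true  h     = z≤n
𝟙-∧-not-∨ true  false true  = s≤s z≤n
𝟙-∧-not-∨ true  false false = s≤s z≤n

PathIn : ∀ {n} → 3Graph n → Subset n → ℕ → Set
PathIn H R k = ∃[ P ] IsPath H P × All (λ v → lookup R v ≡ true) P × length P ≡ k

module LiveTriples {n} (H : 3Graph n) (R : Subset n) where

  inR : Fin n → Bool
  inR = lookup R

  spanned : Fin n → Fin n → Fin n → Bool
  spanned a b c = edge H a b c ∧ (inR a ∧ (inR b ∧ inR c))

  broken : List (Pair n) → Fin n → Fin n → Fin n → Bool
  broken D a b c = deleted D a b ∨ (deleted D b c ∨ deleted D a c)

  live : List (Pair n) → Fin n → Fin n → Fin n → Bool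
  live D a b c = spanned a b c ∧ not (broken D a b c)

  live-swap₁₂ : ∀ D a b c → live D a b c ≡ live D b a c
  live-swap₁₂ D a b c = cong₂ (λ s k → s ∧ not k)
    (cong₂ _∧_ (sym₁₂ H a b c) (∧.x∙yz≈y∙xz (inR a) (inR b) (inR c)))
    (cong₂ _∨_ (deleted-sym D a b) (∨-comm (deleted D b c) (deleted D a c)))

  live-swap₂₃ : ∀ D a b c → live D a b c ≡ live D a c b
  live-swap₂₃ D a b c = cong₂ (λ s k → s ∧ not k)
    (cong₂ _∧_ (sym₂₃ H a b c) (cong (inR a ∧_) (∧-comm (inR b) (inR c))))
    (trans (∨.x∙yz≈z∙yx (deleted D a b) (deleted D b c) (deleted D a c))
           (cong (λ x → deleted D a c ∨ (x ∨ deleted D a b)) (deleted-sym D b c)))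

  live-rotate : ∀ D a b c → live D a b c ≡ live D c a b
  live-rotate D a b c = trans (live-swap₂₃ D a b c) (live-swap₁₂ D a c b)

  live⇒edge : ∀ D {a b c} → live D a b c ≡ true → edge H a b c ≡ true
  live⇒edge D {a} {b} {c} l = ∧-true-l (edge H a b c) (∧-true-l (spanned a b c) l)

  live⇒inR : ∀ D {a b c} → live D a b c ≡ true → inR a ≡ true
  live⇒inR D {a} {b} {c} l = ∧-true-l (inR a) (∧-true-r (edge H a b c) (∧-true-l (spanned a b c) l))

  live⇒undeleted : ∀ D {a b c} → live D a b c ≡ true → deleted D a b ≡ false
  live⇒undeleted D {a} {b} {c} l = ∨-false-l (deleted D a b) (not-true (∧-true-r (spanned a b c) l))

  liveCount : List (Pair n) → ℕ
  liveCount D = ∑³ (λ a b c → 𝟙 (live D a b c))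

  codegree : List (Pair n) → Fin n → Fin n → ℕ
  codegree D a b = sum (λ c → 𝟙 (live D a b c))

  touches : Pair n → Fin n → Fin n → Fin n → Bool
  touches p a b c = covers p a b ∨ (covers p b c ∨ covers p a c)

  broken-∷ : ∀ p D a b c → broken (p ∷ D) a b c ≡ touches p a b c ∨ broken D a b c
  broken-∷ p D a b c = trans
    (cong ((covers p a b ∨ deleted D a b) ∨_) (∨.interchange (covers p b c) (deleted D b c) (covers p a c) (deleted D a c)))
    (∨.interchange (covers p a b) (deleted D a b) (covers p b c ∨ covers p a c) (deleted D b c ∨ deleted D a c))

  module _ (D : List (Pair n)) (u w : Fin n) where

    private
      A : Fin n → Fin n → Fin n → ℕ
      A a b c = 𝟙 (live D a b c)

      t₁ t₂ t₃ t₄ t₅ t₆ : Fin n → Fin n → Fin n → ℕ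
      t₁ a b c = δ a u * (δ b w * A a b c)
      t₂ a b c = δ a w * (δ b u * A a b c)
      t₃ a b c = δ b u * (δ c w * A a b c)
      t₄ a b c = δ b w * (δ c u * A a b c)
      t₅ a b c = δ a u * (δ c w * A a b c)
      t₆ a b c = δ a w * (δ c u * A a b c)

      pinned : Fin n → Fin n → Fin n → ℕ
      pinned = (t₁ +³ t₂) +³ (t₃ +³ t₄) +³ (t₅ +³ t₆)

      𝟙-live-∷ : ∀ a b c → A a b c ≤ 𝟙 (live ((u , w) ∷ D) a b c) + pinned a b c
      𝟙-live-∷ a b c = begin
        A a b c
          ≤⟨ 𝟙-∧-not-∨ (spanned a b c) (broken D a b c) (touches (u , w) a b c) ⟩
        𝟙 (spanned a b c ∧ not (touches (u , w) a b c ∨ broken D a b c)) + A a b c * 𝟙 (touches (u , w) a b c)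
          ≡⟨ cong (λ k → 𝟙 (spanned a b c ∧ not k) + A a b c * 𝟙 (touches (u , w) a b c)) (broken-∷ (u , w) D a b c) ⟨
        𝟙 (live ((u , w) ∷ D) a b c) + A a b c * 𝟙 (touches (u , w) a b c)
          ≤⟨ +-monoʳ-≤ _ (*-monoʳ-≤ (A a b c) (≤-trans (𝟙-∨ (covers (u , w) a b) _)
               (+-mono-≤ (𝟙-covers u w a b) (≤-trans (𝟙-∨ (covers (u , w) b c) _)
                 (+-mono-≤ (𝟙-covers u w b c) (𝟙-covers u w a c)))))) ⟩
        𝟙 (live ((u , w) ∷ D) a b c) + A a b c * ((δ a u * δ b w + δ a w * δ b u)
                 + ((δ b u * δ c w + δ b w * δ c u) + (δ a u * δ c w + δ a w * δ c u)))
          ≡⟨ cong (_+_ (𝟙 (live ((u , w) ∷ D) a b c))) (expand (A a b c) (δ a u) (δ b w) (δ a w) (δ b u) (δ c w) (δ c u)) ⟩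
        𝟙 (live ((u , w) ∷ D) a b c) + pinned a b c ∎
        where
        open ≤-Reasoning
        expand : ∀ x au bw aw bu cw cu →
          x * ((au * bw + aw * bu) + ((bu * cw + bw * cu) + (au * cw + aw * cu)))
            ≡ au * (bw * x) + aw * (bu * x) + (bu * (cw * x) + bw * (cu * x)) + (au * (cw * x) + aw * (cu * x))
        expand = solve-∀

    liveCount-∷ : liveCount D ≤ liveCount ((u , w) ∷ D) + 6 * codegree D u w
    liveCount-∷ = begin
      liveCount D                                                   ≤⟨ ∑³-mono-≤ 𝟙-live-∷ ⟩
      ∑³ ((λ a b c → 𝟙 (live ((u , w) ∷ D) a b c)) +³ pinned)       ≡⟨ ∑³-distrib-+ (λ a b c → 𝟙 (live ((u , w) ∷ D) a b c)) pinned ⟩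
      liveCount ((u , w) ∷ D) + ∑³ pinned                           ≡⟨ cong (_+_ (liveCount ((u , w) ∷ D))) ∑³-pinned ⟩
      liveCount ((u , w) ∷ D) + 6 * codegree D u w                  ∎
      where
      open ≤-Reasoning
      ∑³-+≡ : ∀ {f g : Fin n → Fin n → Fin n → ℕ} {x y} → ∑³ f ≡ x → ∑³ g ≡ y → ∑³ (f +³ g) ≡ x + y
      ∑³-+≡ {f} {g} p q = trans (∑³-distrib-+ f g) (cong₂ _+_ p q)

      ∑³-pinned : ∑³ pinned ≡ 6 * codegree D u w
      ∑³-pinned = begin-equality
        ∑³ pinned                 ≡⟨ ∑³-+≡ (∑³-+≡ (∑³-+≡ e₁ e₂) (∑³-+≡ e₃ e₄)) (∑³-+≡ e₅ e₆) ⟩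
        k + k + (k + k) + (k + k) ≡⟨ six k ⟩
        6 * k                     ∎
        where
        k = codegree D u w
        e₁ : ∑³ t₁ ≡ k
        e₁ = ∑³-pin₁₂ u w A
        e₂ : ∑³ t₂ ≡ k
        e₂ = trans (∑³-pin₁₂ w u A) (sum-cong-≗ λ c → cong 𝟙 (live-swap₁₂ D w u c))
        e₃ : ∑³ t₃ ≡ k
        e₃ = trans (∑³-pin₂₃ u w A) (sum-cong-≗ λ a → cong 𝟙 (sym (live-rotate D u w a)))
        e₄ : ∑³ t₄ ≡ k
        e₄ = trans (∑³-pin₂₃ w u A) (sum-cong-≗ λ a → cong 𝟙
               (trans (live-swap₁₂ D a w u) (trans (live-swap₂₃ D w a u) (live-swap₁₂ D w u a))))
        e₅ : ∑³ t₅ ≡ k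
        e₅ = trans (∑³-pin₁₃ u w A) (sum-cong-≗ λ b → cong 𝟙 (live-swap₂₃ D u b w))
        e₆ : ∑³ t₆ ≡ k
        e₆ = trans (∑³-pin₁₃ w u A) (sum-cong-≗ λ b → cong 𝟙 (trans (live-swap₂₃ D w b u) (live-swap₁₂ D w u b)))
        six : ∀ k → k + k + (k + k) + (k + k) ≡ 6 * k
        six = solve-∀

  undeletedPairs : List (Pair n) → ℕ
  undeletedPairs D = sum λ u → sum λ w → 𝟙 (not (deleted D u w))

  undeletedPairs≤n² : ∀ D → undeletedPairs D ≤ n * (n * 1)
  undeletedPairs≤n² D = sum≤n*c λ u → sum≤n*c λ w → 𝟙≤1 (not (deleted D u w))

  undeletedPairs-∷ : ∀ D {a b} → deleted D a b ≡ false → undeletedPairs ((a , b) ∷ D) < undeletedPairs D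
  undeletedPairs-∷ D {a} {b} undeleted =
    sum-mono-< (λ u → sum-mono-≤ λ w → 𝟙-not-∨ (covers (a , b) u w) (deleted D u w)) a
      (sum-mono-< (λ w → 𝟙-not-∨ (covers (a , b) a w) (deleted D a w)) b newlyDeleted)
    where
    newlyDeleted : 𝟙 (not (covers (a , b) a b ∨ deleted D a b)) < 𝟙 (not (deleted D a b))
    newlyDeleted rewrite dec-true (a ≟ a) refl | dec-true (b ≟ b) refl | undeleted = s≤s z≤n

  module _ (k : ℕ) where

    Robust : List (Pair n) → Set
    Robust D = ∀ a b c → live D a b c ≡ true → k ≤ codegree D a b

    HasLive : List (Pair n) → Set
    HasLive D = ∃[ a ] ∃[ b ] ∃[ c ] live D a b c ≡ true

    prune : ∀ D → Acc _<_ (undeletedPairs D) →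
            liveCount D ≤ 6 * k * undeletedPairs D ⊎ ∃[ D′ ] Robust D′ × HasLive D′
    prune D (acc rec) with any? (λ a → any? λ b → any? λ c → (live D a b c Bool.≟ true) ×-dec (codegree D a b <? k))
    ... | yes (a , b , c , l , low) with prune ((a , b) ∷ D) (rec (undeletedPairs-∷ D (live⇒undeleted D l)))
    ...   | inj₂ found = inj₂ found
    ...   | inj₁ few = inj₁ (begin
      liveCount D                                     ≤⟨ liveCount-∷ D a b ⟩
      liveCount D′ + 6 * codegree D a b               ≤⟨ +-mono-≤ few (*-monoʳ-≤ 6 (<⇒≤ low)) ⟩
      6 * k * undeletedPairs D′ + 6 * k               ≡⟨ +-comm (6 * k * undeletedPairs D′) (6 * k) ⟩
      6 * k + 6 * k * undeletedPairs D′               ≡⟨ *-suc (6 * k) (undeletedPairs D′) ⟨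
      6 * k * suc (undeletedPairs D′)                 ≤⟨ *-monoʳ-≤ (6 * k) (undeletedPairs-∷ D (live⇒undeleted D l)) ⟩
      6 * k * undeletedPairs D                        ∎)
      where
      open ≤-Reasoning
      D′ = (a , b) ∷ D
    prune D _ | no noLow with any? (λ a → any? λ b → any? λ c → live D a b c Bool.≟ true)
    ... | yes someLive = inj₂ (D , robust , someLive)
      where
      robust : Robust D
      robust a b c l = ≮⇒≥ λ low → noLow (a , b , c , l , low)
    ... | no noLive = inj₁ (≤-trans (≤-reflexive noTriples) z≤n)
      where
      noTriples : liveCount D ≡ 0
      noTriples = sum-zero λ a → sum-zero λ b → sum-zero λ c → dead a b c
        where
        dead : ∀ a b c → 𝟙 (live D a b c) ≡ 0
        dead a b c with live D a b c in l
        ... | true  = ⊥-elim (noLive (a , b , c , l))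
        ... | false = refl

    prune-to-robust : 6 * k * (n * (n * 1)) < liveCount [] → ∃[ D ] Robust D × HasLive D
    prune-to-robust many with prune [] (<-wellFounded (undeletedPairs []))
    ... | inj₂ found = found
    ... | inj₁ few = ⊥-elim (<⇒≱ many (≤-trans few (*-monoʳ-≤ (6 * k) (undeletedPairs≤n² []))))

    module _ {D} (robust : Robust D) where

      codegree≤length : ∀ {x y} P → Unique P → (∀ z → live D x y z ≡ true → z ∈ᵇ P ≡ true) → codegree D x y ≤ length P
      codegree≤length {x} {y} P uniq covered = ≤-trans (sum-mono-≤ pointwise) (≤-reflexive (sum-∈ᵇ uniq))
        where
        pointwise : ∀ z → 𝟙 (live D x y z) ≤ 𝟙 (z ∈ᵇ P)
        pointwise z with live D x y z in l
        ... | false = z≤n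
        ... | true rewrite covered z l = ≤-refl

      extend : ∀ j x y rest → Unique (x ∷ y ∷ rest) → TightEdges H (x ∷ y ∷ rest) →
               All (λ v → inR v ≡ true) (x ∷ y ∷ rest) → k ≤ codegree D x y →
               j + length (x ∷ y ∷ rest) ≡ k → PathIn H R k
      extend zero x y rest uniq tight inside _ len = x ∷ y ∷ rest , (uniq , tight) , inside , len
      extend (suc j) x y rest uniq tight inside deg len
        with any? (λ z → (live D x y z Bool.≟ true) ×-dec (z ∈ᵇ (x ∷ y ∷ rest) Bool.≟ false))
      ... | yes (z , l , fresh) =
        extend j z x (y ∷ rest) (¬Any⇒All¬ _ (∈ᵇ-false⇒∉ _ fresh) ∷ uniq) (live⇒edge D l′ , tight)
               (live⇒inR D l′ ∷ inside) (robust z x y l′) (trans (+-suc j _) len)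
        where
        l′ : live D z x y ≡ true
        l′ = trans (sym (live-rotate D x y z)) l
      ... | no noFresh = ⊥-elim (<⇒≱ short (≤-trans deg (codegree≤length (x ∷ y ∷ rest) uniq covered)))
        where
        short : length (x ∷ y ∷ rest) < k
        short = ≤-trans (s≤s (m≤n+m _ j)) (≤-reflexive len)
        covered : ∀ z → live D x y z ≡ true → z ∈ᵇ (x ∷ y ∷ rest) ≡ true
        covered z l with z ∈ᵇ (x ∷ y ∷ rest) in m
        ... | true  = refl
        ... | false = ⊥-elim (noFresh (z , l , m))

      robust-path : 2 ≤ k → HasLive D → PathIn H R k
      robust-path 2≤k (a , b , c , l) =
        extend (k ∸ 2) a b [] ((a≢b ∷ []) ∷ [] ∷ []) tt (live⇒inR D l ∷ live⇒inR D l′ ∷ []) (robust a b c l) (m∸n+n≡m 2≤k)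
        where
        l′ : live D b a c ≡ true
        l′ = trans (sym (live-swap₁₂ D a b c)) l
        a≢b : a ≢ b
        a≢b refl with () ← trans (sym (live⇒edge D l)) (loopless H a c)

  eH≤liveCount : eH H R ≤ liveCount []
  eH≤liveCount = ≤-trans (≤-reflexive eH≡) (∑³-mono-≤ pointwise)
    where
    inside? : ∀ i j k → Dec (i Fin.< j × j Fin.< k × i ∈ R × j ∈ R × k ∈ R × edge H i j k ≡ true)
    inside? i j k = (i Fin.<? j) ×-dec (j Fin.<? k) ×-dec (i ∈? R) ×-dec (j ∈? R) ×-dec (k ∈? R) ×-dec (edge H i j k Bool.≟ true)
    eH≡ : eH H R ≡ ∑³ (λ i j k → 𝟙 (does (inside? i j k)))
    eH≡ = length-filter-triples {n} _
    pointwise : ∀ i j k → 𝟙 (does (inside? i j k)) ≤ 𝟙 (live [] i j k)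
    pointwise i j k = 𝟙-does-≤ (inside? i j k) inside⇒live
      where
      inside⇒live : i Fin.< j × j Fin.< k × i ∈ R × j ∈ R × k ∈ R × edge H i j k ≡ true → live [] i j k ≡ true
      inside⇒live (_ , _ , i∈R , j∈R , k∈R , e) rewrite e | []=⇒lookup i∈R | []=⇒lookup j∈R | []=⇒lookup k∈R = refl

-- Covering greedily by paths

greedy-cover : ∀ {n} (H : 3Graph n) (ζ : ℚ) {L γ : ℕ} → n < γ * L →
               (∀ R → ζ ℚ.* ⟦ n ⟧ ℚ.< ⟦ ∣ R ∣ ⟧ → PathIn H R L) → CoverablePaths H ζ γ
greedy-cover {n} H ζ {L} {γ} n<γL pathIn = extend γ [] ([] , [] , refl) refl (enough? [])
  where
  PartialCover : List (List (Fin n)) → Set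
  PartialCover Ps = All (IsPath H) Ps × Unique (concat Ps) × length (concat Ps) ≡ length Ps * L

  enough? : ∀ Ps → Dec (⟦ n ∸ length (concat Ps) ⟧ ℚ.≤ ζ ℚ.* ⟦ n ⟧)
  enough? Ps = ⟦ n ∸ length (concat Ps) ⟧ ℚ.≤? ζ ℚ.* ⟦ n ⟧

  extend : ∀ g Ps → PartialCover Ps → length Ps + g ≡ γ → Dec (⟦ n ∸ length (concat Ps) ⟧ ℚ.≤ ζ ℚ.* ⟦ n ⟧) →
           CoverablePaths H ζ γ
  extend g Ps (paths , uniq , _) used (yes few) = Ps , ≤-trans (m≤m+n (length Ps) g) (≤-reflexive used) , paths , uniq , few
  extend zero Ps (_ , uniq , len) used (no _) = ⊥-elim (<⇒≱ n<γL γL≤n)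
    where
    γL≤n : γ * L ≤ n
    γL≤n = begin
      γ * L                                        ≡⟨ cong (_* L) (trans (sym used) (+-identityʳ (length Ps))) ⟩
      length Ps * L                                ≡⟨ len ⟨
      length (concat Ps)                           ≤⟨ m≤n+m _ ∣ outside (concat Ps) ∣ ⟩
      ∣ outside (concat Ps) ∣ + length (concat Ps) ≡⟨ ∣outside∣+length uniq ⟩
      n                                            ∎
      where open ≤-Reasoning
  extend (suc g) Ps (paths , uniq , len) used (no many) = addPath (pathIn (outside (concat Ps)) many′)
    where
    many′ : ζ ℚ.* ⟦ n ⟧ ℚ.< ⟦ ∣ outside (concat Ps) ∣ ⟧
    many′ = subst (λ x → ζ ℚ.* ⟦ n ⟧ ℚ.< ⟦ x ⟧)
      (trans (cong (_∸ length (concat Ps)) (sym (∣outside∣+length uniq))) (m+n∸n≡m ∣ outside (concat Ps) ∣ (length (concat Ps))))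
      (ℚ.≰⇒> many)
    addPath : PathIn H (outside (concat Ps)) L → CoverablePaths H ζ γ
    addPath (P , isPath@(uniqP , _) , inside , lenP) =
      extend g (P ∷ Ps) (isPath ∷ paths , ++⁺ uniqP uniq disjoint , trans (length-++ P) (cong₂ _+_ lenP len))
             (trans (sym (+-suc (length Ps) g)) used) (enough? (P ∷ Ps))
      where
      disjoint : Disjoint P (concat Ps)
      disjoint {v} (v∈P , v∈Ps) =
        ∈ᵇ-false⇒∉ (concat Ps) (not-true (trans (sym (lookup∘tabulate _ v)) (All.lookup inside v∈P))) v∈Ps

-- Translating the rational hypotheses into ℕ

1/suc : ℕ → ℚ
1/suc q = ℚ.mkℚ (+ 1) q (1-coprimeTo (suc q))

∃1/suc≤ : ∀ {d} → 0ℚ ℚ.< d → ∃[ q ] 1/suc q ℚ.≤ d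
∃1/suc≤ {ℚ.mkℚ (+ zero)    q _} (ℚ.*<* (ℤ.+<+ ()))
∃1/suc≤ {ℚ.mkℚ ℤ.+[1+ p ] q _} _ = q , ℚ.*≤* (ℤ.*-monoʳ-≤-nonNeg (+ suc q) {+ 1} {ℤ.+[1+ p ]} (ℤ.+≤+ (s≤s z≤n)))
∃1/suc≤ {ℚ.mkℚ ℤ.-[1+ p ] q _} (ℚ.*<* ())

⟦⟧-nonNeg : ∀ a → ℚ.NonNegative ⟦ a ⟧
⟦⟧-nonNeg a = ℚ.normalize-nonNeg a 1

toℚᵘ-⟦⟧ : ∀ a → ℚ.toℚᵘ ⟦ a ⟧ ℚᵘ.≃ ℚᵘ.mkℚᵘ (+ a) 0
toℚᵘ-⟦⟧ a = ℚ.toℚᵘ-fromℚᵘ (ℚᵘ.mkℚᵘ (+ a) 0)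

toℚᵘ-1/suc*⟦⟧ : ∀ q a → ℚ.toℚᵘ (1/suc q ℚ.* ⟦ a ⟧) ℚᵘ.≃ ℚᵘ.mkℚᵘ (+ 1) q ℚᵘ.* ℚᵘ.mkℚᵘ (+ a) 0
toℚᵘ-1/suc*⟦⟧ q a = ℚᵘ.≃-trans (ℚ.toℚᵘ-homo-* (1/suc q) ⟦ a ⟧) (ℚᵘ.*-congˡ {ℚᵘ.mkℚᵘ (+ 1) q} (toℚᵘ-⟦⟧ a))

ℚ-proportion⇒ℕ : ∀ z n m {ζ} → 1/suc z ℚ.≤ ζ → ζ ℚ.* ⟦ n ⟧ ℚ.< ⟦ m ⟧ → n < suc z * m
ℚ-proportion⇒ℕ z n m {ζ} 1/z≤ζ ζn<m
  with ℚᵘ.<-respʳ-≃ (toℚᵘ-⟦⟧ m) (ℚᵘ.<-respˡ-≃ (toℚᵘ-1/suc*⟦⟧ z n)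
         (ℚ.toℚᵘ-mono-< (ℚ.≤-<-trans (ℚ.*-monoʳ-≤-nonNeg ⟦ n ⟧ {{⟦⟧-nonNeg n}} 1/z≤ζ) ζn<m)))
... | ℚᵘ.*<* n<m = subst (n <_) (comm m z) (ℤ.drop‿+<+ (subst₂ ℤ._<_ (unit (+ n)) (sym (ℤ.pos-* m (suc z * 1))) n<m))
  where
  comm : ∀ m z → m * (suc z * 1) ≡ suc z * m
  comm = solve-∀
  unit : ∀ x → (ℤ.1ℤ ℤ.* x) ℤ.* ℤ.1ℤ ≡ x
  unit = ℤ-Solver.solve-∀

ℚ-density⇒ℕ : ∀ q K a b c {d ρ} → 1/suc q ℚ.≤ d → ρ ℚ.≤ 1/suc K → d ℚ.* ⟦ a ⟧ ℚ.- ρ ℚ.* ⟦ b ⟧ ℚ.≤ ⟦ c ⟧ →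
              suc K * a ≤ suc q * suc K * c + suc q * b
ℚ-density⇒ℕ q K a b c {d} {ρ} 1/q≤d ρ≤1/K da-ρb≤c with unnormalised
  where
  weakened : 1/suc q ℚ.* ⟦ a ⟧ ℚ.- 1/suc K ℚ.* ⟦ b ⟧ ℚ.≤ ⟦ c ⟧
  weakened = ℚ.≤-trans (ℚ.+-mono-≤ (ℚ.*-monoʳ-≤-nonNeg ⟦ a ⟧ {{⟦⟧-nonNeg a}} 1/q≤d)
                                   (ℚ.neg-antimono-≤ (ℚ.*-monoʳ-≤-nonNeg ⟦ b ⟧ {{⟦⟧-nonNeg b}} ρ≤1/K))) da-ρb≤c
  unnormalised : ℚᵘ.mkℚᵘ (+ 1) q ℚᵘ.* ℚᵘ.mkℚᵘ (+ a) 0 ℚᵘ.- ℚᵘ.mkℚᵘ (+ 1) K ℚᵘ.* ℚᵘ.mkℚᵘ (+ b) 0 ℚᵘ.≤ ℚᵘ.mkℚᵘ (+ c) 0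
  unnormalised = ℚᵘ.≤-respʳ-≃ (toℚᵘ-⟦⟧ c) (ℚᵘ.≤-respˡ-≃ toℚᵘ-lhs (ℚ.toℚᵘ-mono-≤ weakened))
    where
    toℚᵘ-lhs : ℚ.toℚᵘ (1/suc q ℚ.* ⟦ a ⟧ ℚ.- 1/suc K ℚ.* ⟦ b ⟧)
               ℚᵘ.≃ ℚᵘ.mkℚᵘ (+ 1) q ℚᵘ.* ℚᵘ.mkℚᵘ (+ a) 0 ℚᵘ.- ℚᵘ.mkℚᵘ (+ 1) K ℚᵘ.* ℚᵘ.mkℚᵘ (+ b) 0
    toℚᵘ-lhs = ℚᵘ.≃-trans (ℚ.toℚᵘ-homo-+ (1/suc q ℚ.* ⟦ a ⟧) (ℚ.- (1/suc K ℚ.* ⟦ b ⟧)))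
      (ℚᵘ.+-cong (toℚᵘ-1/suc*⟦⟧ q a) (ℚᵘ.≃-trans (ℚ.toℚᵘ-homo‿- (1/suc K ℚ.* ⟦ b ⟧)) (ℚᵘ.-‿cong (toℚᵘ-1/suc*⟦⟧ K b))))
... | ℚᵘ.*≤* cross = subst₂ _≤_ (lhs a K) (rhs q K b c)
      (ℤ.drop‿+≤+ (subst₂ ℤ._≤_ (sym (ℤ.pos-* a (suc K * 1))) (ℤ-rhs c b (suc q * 1) (suc K * 1))
        (ℤ.≤-trans (ℤ.≤-reflexive (isolate (+ a) (+ b) (+ (suc q * 1)) (+ (suc K * 1))))
          (ℤ.+-monoˡ-≤ (+ b ℤ.* + (suc q * 1)) cross))))
  where
  isolate : ∀ x y Q K → x ℤ.* K ≡ ((ℤ.1ℤ ℤ.* x) ℤ.* K ℤ.+ (ℤ.- (ℤ.1ℤ ℤ.* y)) ℤ.* Q) ℤ.* ℤ.1ℤ ℤ.+ y ℤ.* Q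
  isolate = ℤ-Solver.solve-∀
  ℤ-rhs : ∀ c b Q K → + c ℤ.* (+ Q ℤ.* + K) ℤ.+ + b ℤ.* + Q ≡ + (c * (Q * K) + b * Q)
  ℤ-rhs c b Q K = trans (cong₂ ℤ._+_ (trans (cong (+ c ℤ.*_) (sym (ℤ.pos-* Q K))) (sym (ℤ.pos-* c (Q * K))))
                                     (sym (ℤ.pos-* b Q)))
                        (sym (ℤ.pos-+ (c * (Q * K)) (b * Q)))
  lhs : ∀ a K → a * (suc K * 1) ≡ suc K * a
  lhs = solve-∀
  rhs : ∀ q K b c → c * ((suc q * 1) * (suc K * 1)) + b * (suc q * 1) ≡ suc q * suc K * c + suc q * b
  rhs = solve-∀

-- Binomial coefficients and the edge count

2*[1+n]C2 : ∀ n → 2 * (suc n C 2) ≡ suc n * n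
2*[1+n]C2 zero    = refl
2*[1+n]C2 (suc n) = begin
  2 * (suc (suc n) C 2)             ≡⟨ cong (2 *_) (nCk+nC[k+1]≡[n+1]C[k+1] (suc n) 1) ⟨
  2 * (suc n C 1 + suc n C 2)       ≡⟨ *-distribˡ-+ 2 (suc n C 1) (suc n C 2) ⟩
  2 * (suc n C 1) + 2 * (suc n C 2) ≡⟨ cong₂ (λ x y → 2 * x + y) (nC1≡n (suc n)) (2*[1+n]C2 n) ⟩
  2 * suc n + suc n * n             ≡⟨ pascal n ⟩
  suc (suc n) * suc n               ∎
  where
  open ≡-Reasoning
  pascal : ∀ n → 2 * suc n + suc n * n ≡ suc (suc n) * suc n
  pascal = solve-∀

6*[2+n]C3 : ∀ n → 6 * (suc (suc n) C 3) ≡ suc (suc n) * (suc n * n)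
6*[2+n]C3 zero    = refl
6*[2+n]C3 (suc n) = begin
  6 * (suc (suc (suc n)) C 3)                           ≡⟨ cong (6 *_) (nCk+nC[k+1]≡[n+1]C[k+1] (suc (suc n)) 2) ⟨
  6 * (suc (suc n) C 2 + suc (suc n) C 3)               ≡⟨ split (suc (suc n) C 2) (suc (suc n) C 3) ⟩
  3 * (2 * (suc (suc n) C 2)) + 6 * (suc (suc n) C 3)   ≡⟨ cong₂ (λ x y → 3 * x + y) (2*[1+n]C2 (suc n)) (6*[2+n]C3 n) ⟩
  3 * (suc (suc n) * suc n) + suc (suc n) * (suc n * n) ≡⟨ pascal n ⟩
  suc (suc (suc n)) * (suc (suc n) * suc n)             ∎
  where
  open ≡-Reasoning
  split : ∀ x y → 6 * (x + y) ≡ 3 * (2 * x) + 6 * y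
  split = solve-∀
  pascal : ∀ n → 3 * (suc (suc n) * suc n) + suc (suc n) * (suc n * n) ≡ suc (suc (suc n)) * (suc (suc n) * suc n)
  pascal = solve-∀

^3≤24*C3 : ∀ m → 4 ≤ m → m ^ 3 ≤ 24 * (m C 3)
^3≤24*C3 1 (s≤s ())
^3≤24*C3 2 (s≤s (s≤s ()))
^3≤24*C3 3 (s≤s (s≤s (s≤s ())))
^3≤24*C3 m@(suc (suc (suc (suc t)))) _ = begin
  m ^ 3                                                  ≤⟨ *-monoʳ-≤ m (*-mono-≤ m≤2[m∸1] (*-monoˡ-≤ 1 m≤2[m∸2])) ⟩
  m * (2 * suc (suc (suc t)) * (2 * suc (suc t) * 1))    ≡⟨ regroup m (suc (suc (suc t))) (suc (suc t)) ⟩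
  4 * (m * (suc (suc (suc t)) * suc (suc t)))            ≡⟨ cong (4 *_) (6*[2+n]C3 (suc (suc t))) ⟨
  4 * (6 * (m C 3))                                      ≡⟨ *-assoc 4 6 (m C 3) ⟨
  24 * (m C 3)                                           ∎
  where
  open ≤-Reasoning
  m≤2[m∸1] : m ≤ 2 * suc (suc (suc t))
  m≤2[m∸1] = ≤-trans (m≤m+n m (suc (suc t))) (≤-reflexive (double t))
    where
    double : ∀ t → suc (suc (suc (suc t))) + suc (suc t) ≡ 2 * suc (suc (suc t))
    double = solve-∀
  m≤2[m∸2] : m ≤ 2 * suc (suc t)
  m≤2[m∸2] = ≤-trans (m≤m+n m t) (≤-reflexive (double t))
    where
    double : ∀ t → suc (suc (suc (suc t))) + t ≡ 2 * suc (suc t)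
    double = solve-∀
  regroup : ∀ x a b → x * (2 * a * (2 * b * 1)) ≡ 4 * (x * (a * b))
  regroup = solve-∀

many-edges : ∀ q Z K L n m e .{{_ : NonZero q}} →
  48 * q * Z ^ 3 ≤ K → 6 * K * L ≤ n → 4 * Z ≤ n → n < Z * m →
  K * (m C 3) ≤ q * K * e + q * n ^ 3 → 6 * L * n ^ 2 < e
many-edges q Z K L n m e 48qZ³≤K 6KL≤n 4Z≤n n<Zm dense = ≰⇒> λ e≤6Ln² → <-irrefl refl (begin-strict
  K * (24 * (m C 3))             ≡⟨ x*[y*z]≡y*[x*z] K 24 (m C 3) ⟩
  24 * (K * (m C 3))             ≤⟨ *-monoʳ-≤ 24 (≤-trans dense (+-monoˡ-≤ (q * n ^ 3) (qKe≤qn³ e≤6Ln²))) ⟩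
  24 * (q * n ^ 3 + q * n ^ 3)   ≡⟨ double q (n ^ 3) ⟩
  48 * q * n ^ 3                 <⟨ *-monoʳ-< (48 * q) {{m*n≢0 48 q}} (^-monoˡ-< 3 n<Zm) ⟩
  48 * q * (Z * m) ^ 3           ≡⟨ distribute q Z m ⟩
  48 * q * Z ^ 3 * m ^ 3         ≤⟨ *-monoˡ-≤ (m ^ 3) 48qZ³≤K ⟩
  K * m ^ 3                      ≤⟨ *-monoʳ-≤ K (^3≤24*C3 m 4≤m) ⟩
  K * (24 * (m C 3))             ∎)
  where
  open ≤-Reasoning
  4≤m : 4 ≤ m
  4≤m = <⇒≤ (*-cancelˡ-< Z 4 m (≤-<-trans (≤-reflexive (*-comm Z 4)) (≤-<-trans 4Z≤n n<Zm)))
  regroup : ∀ a b c d → a * b * (6 * c * (d * (d * 1))) ≡ a * (6 * b * c) * (d * (d * 1))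
  regroup = solve-∀
  qKe≤qn³ : e ≤ 6 * L * n ^ 2 → q * K * e ≤ q * n ^ 3
  qKe≤qn³ e≤6Ln² = begin
    q * K * e                 ≤⟨ *-monoʳ-≤ (q * K) e≤6Ln² ⟩
    q * K * (6 * L * n ^ 2)   ≡⟨ regroup q K L n ⟩
    q * (6 * K * L) * n ^ 2   ≤⟨ *-monoˡ-≤ (n ^ 2) (*-monoʳ-≤ q 6KL≤n) ⟩
    q * n * n ^ 2             ≡⟨ *-assoc q n (n ^ 2) ⟩
    q * n ^ 3                 ∎
  x*[y*z]≡y*[x*z] : ∀ x y z → x * (y * z) ≡ y * (x * z)
  x*[y*z]≡y*[x*z] = solve-∀
  double : ∀ q c → 24 * (q * c + q * c) ≡ 48 * q * c
  double = solve-∀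
  distribute : ∀ q Z m → 48 * q * (Z * m * (Z * m * (Z * m * 1))) ≡ 48 * q * (Z * (Z * (Z * 1))) * (m * (m * (m * 1)))
  distribute = solve-∀

m<2*n*[m/n] : ∀ m n .{{_ : NonZero n}} → 1 ≤ m / n → m < 2 * n * (m / n)
m<2*n*[m/n] m n 1≤m/n = begin-strict
  m                           ≡⟨ m≡m%n+[m/n]*n m n ⟩
  m % n + m / n * n           <⟨ +-monoˡ-< (m / n * n) (m%n<n m n) ⟩
  n + m / n * n               ≤⟨ +-monoˡ-≤ (m / n * n) (≤-trans (≤-reflexive (sym (*-identityʳ n))) (*-monoʳ-≤ n 1≤m/n)) ⟩
  n * (m / n) + m / n * n     ≡⟨ double n (m / n) ⟩
  2 * n * (m / n)             ∎
  where
  open ≤-Reasoning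
  double : ∀ n l → n * l + l * n ≡ 2 * n * l
  double = solve-∀

dense⇒path : ∀ {n} (H : 3Graph n) (R : Subset n) q z K L {d ζ ρ} →
  1/suc q ℚ.≤ d → 1/suc z ℚ.≤ ζ → ρ ℚ.≤ 1/suc K → 48 * suc q * suc z ^ 3 ≤ suc K →
  6 * suc K * L ≤ n → 4 * suc z ≤ n → 2 ≤ L → Dense ρ d H →
  ζ ℚ.* ⟦ n ⟧ ℚ.< ⟦ ∣ R ∣ ⟧ → PathIn H R L
dense⇒path {n} H R q z K L 1/q≤d 1/z≤ζ ρ≤1/K K-large 6KL≤n 4Z≤n 2≤L dense many = pick (prune-to-robust R L (<-≤-trans manyEdges (eH≤liveCount R)))
  where
  open LiveTriples H
  manyEdges : 6 * L * n ^ 2 < eH H R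
  manyEdges = many-edges (suc q) (suc z) (suc K) L n ∣ R ∣ (eH H R) K-large 6KL≤n 4Z≤n
    (ℚ-proportion⇒ℕ z n ∣ R ∣ 1/z≤ζ many)
    (ℚ-density⇒ℕ q K (∣ R ∣ C 3) (n ^ 3) (eH H R) 1/q≤d ρ≤1/K (dense R))
  pick : ∃[ D ] LiveTriples.Robust H R L D × LiveTriples.HasLive H R L D → PathIn H R L
  pick (D , robust , someLive) = robust-path R L {D} robust 2≤L someLive

dense⇒coverable : ∀ {n} (H : 3Graph n) q z K {d ζ ρ} →
  1/suc q ℚ.≤ d → 1/suc z ℚ.≤ ζ → ρ ℚ.≤ 1/suc K → 48 * suc q * suc z ^ 3 ≤ suc K →
  12 * suc K + 4 * suc z ≤ n → Dense ρ d H → CoverablePaths H ζ (12 * suc K)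
dense⇒coverable {n} H q z K {ζ = ζ} 1/q≤d 1/z≤ζ ρ≤1/K K-large n-large dense =
  greedy-cover H ζ (subst (λ γ → n < γ * L) (twelve K) (m<2*n*[m/n] n (6 * suc K) (≤-trans (s≤s z≤n) 2≤L)))
    (λ R → dense⇒path H R q z K L 1/q≤d 1/z≤ζ ρ≤1/K K-large 6KL≤n (≤-trans (m≤n+m (4 * suc z) (12 * suc K)) n-large) 2≤L dense)
  where
  L = n / (6 * suc K)
  twelve : ∀ K → 2 * (6 * suc K) ≡ 12 * suc K
  twelve = solve-∀
  2≤L : 2 ≤ L
  2≤L = ≤-trans (≤-reflexive (sym (m*n/n≡m 2 (6 * suc K))))
          (/-monoˡ-≤ (6 * suc K) (≤-trans (≤-reflexive (twelve K)) (≤-trans (m≤m+n (12 * suc K) (4 * suc z)) n-large)))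
  6KL≤n : 6 * suc K * L ≤ n
  6KL≤n = ≤-trans (≤-reflexive (*-comm (6 * suc K) L)) (m/n*n≤m n (6 * suc K))

lemma1p5 : ∀ (d ζ : ℚ) → 0ℚ ℚ.< d → d ℚ.≤ 1ℚ → 0ℚ ℚ.< ζ → ζ ℚ.≤ 1ℚ →
    ∃[ n₃ ] ∃[ ρ₃ ] ∃[ γ ] (0ℚ ℚ.< ρ₃ ×
    (∀ (n : ℕ) → n ≥ n₃ → ∀ (ρ : ℚ) → ρ ℚ.< ρ₃ → ∀ (H : 3Graph n) →
    Dense ρ d H → CoverablePaths H ζ γ))
lemma1p5 d ζ 0<d _ 0<ζ _ with ∃1/suc≤ 0<d | ∃1/suc≤ 0<ζ
... | q , 1/q≤d | z , 1/z≤ζ = constants (48 * suc q * suc z ^ 3) (n≤1+n _)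
  where
  -- K is abstracted: unfolding the closed numeral 48 * suc q * suc z ^ 3 during type-checking is prohibitively expensive.
  constants : ∀ K → 48 * suc q * suc z ^ 3 ≤ suc K → ∃[ n₃ ] ∃[ ρ₃ ] ∃[ γ ] (0ℚ ℚ.< ρ₃ ×
    (∀ (n : ℕ) → n ≥ n₃ → ∀ (ρ : ℚ) → ρ ℚ.< ρ₃ → ∀ (H : 3Graph n) → Dense ρ d H → CoverablePaths H ζ γ))
  constants K K-large = 12 * suc K + 4 * suc z , 1/suc K , 12 * suc K , ℚ.positive⁻¹ (1/suc K) ,
    λ n n≥n₃ ρ ρ<1/K H → dense⇒coverable H q z K 1/q≤d 1/z≤ζ (ℚ.<⇒≤ ρ<1/K) K-large n≥n₃
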